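{- Let $G$ be a finite graph with $\chi(G)\le\sqrt{f(G)}$. Then $v(G)\ge\chi(G)$.
   Context: For a vertex $a$, $G_a$ denotes the subgraph induced on the neighbourhood of $a$; $\theta(H)$ is the minimum number of cliques partitioning the vertex set of $H$ ($0$ for the empty graph); $k(a)=\max\{\theta(G_a),2\}$ and $f(G)=\sum_{a\in V}k(a)$. $\chi(G)$ is the chromatic number. $v(G)$ is the minimum number of points of a linear hypergraph (finite point set, lines are subsets of size $\ge2$, two distinct points in at most one line) whose intersection graph (vertices = lines, adjacent iff distinct and intersecting) is isomorphic to $G$. -}

module Defs where

open import Data.Nat using (ℕ; _≤_; _⊔_; _*_)
open import Data.Bool using (Bool; true; false)
open import Data.Fin using (Fin)
open import Data.Fin.Subset using (Subset; _∈_; ∣_∣)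
open import Data.List using (map; allFin)
open import Data.Nat.ListAction using (sum)
open import Data.Product using (Σ; _×_; ∃-syntax)
open import Relation.Binary.PropositionalEquality using (_≡_; _≢_)
open import Relation.Nullary using (¬_)

record Graph (n : ℕ) : Set where
  field
    adj     : Fin n → Fin n → Bool
    adj-sym : ∀ a b → adj a b ≡ adj b a
    adj-irr : ∀ a → adj a a ≡ false
open Graph public

Adj : ∀ {n} → Graph n → Fin n → Fin n → Set
Adj G a b = adj G a b ≡ true

-- A partition of the vertex set of G_a (the subgraph induced on the
-- neighbourhood of a) into k cliques: a labelling of the neighbours of a
-- with k labels such that distinct neighbours with equal label are adjacent.
CliquePartitionNbhd : ∀ {n} → Graph n → Fin n → ℕ → Set
CliquePartitionNbhd {n} G a k =
  Σ ((b : Fin n) → Adj G a b → Fin k) λ c →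
    ∀ b b' (p : Adj G a b) (p' : Adj G a b') →
      c b p ≡ c b' p' → b ≢ b' → Adj G b b'

IsTheta : ∀ {n} → Graph n → Fin n → ℕ → Set
IsTheta G a t = CliquePartitionNbhd G a t × (∀ k → CliquePartitionNbhd G a k → t ≤ k)

fFrom : ∀ {n} → (Fin n → ℕ) → ℕ
fFrom {n} θ = sum (map (λ a → θ a ⊔ 2) (allFin n))

Colouring : ∀ {n} → Graph n → ℕ → Set
Colouring {n} G k = Σ (Fin n → Fin k) λ c → ∀ a b → Adj G a b → c a ≢ c b

IsChromaticNumber : ∀ {n} → Graph n → ℕ → Set
IsChromaticNumber G χ = Colouring G χ × (∀ k → Colouring G k → χ ≤ k)

-- A linear hypergraph on the point set Fin m whose intersection graph is
-- isomorphic to G, given via the bijection vertex ↦ line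
-- (L is injective, so its image is the set of lines).
LinearRep : ∀ {n} → Graph n → ℕ → Set
LinearRep {n} G m =
  Σ (Fin n → Subset m) λ L →
    (∀ a → 2 ≤ ∣ L a ∣) ×
    (∀ a b → L a ≡ L b → a ≡ b) ×
    (∀ a b → a ≢ b → ∀ p q → p ∈ L a → p ∈ L b → q ∈ L a → q ∈ L b → p ≡ q) ×
    (∀ a b → a ≢ b → Adj G a b → ∃[ p ] (p ∈ L a × p ∈ L b)) ×
    (∀ a b → a ≢ b → ∃[ p ] (p ∈ L a × p ∈ L b) → Adj G a b)

IsV : ∀ {n} → Graph n → ℕ → Set
IsV G v = LinearRep G v × (∀ m → LinearRep G m → v ≤ m)

{-# OPTIONS --safe #-}
-- Fix a linear representation of G by lines on v points. The line of a neighbour b of a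
-- meets the line of a in a point, and neighbours meeting it in the same point are pairwise
-- adjacent; so θ(G_a) is at most the size of the line of a, and f(G) ≤ Σ_a |line a|.
-- Counting incidences by points instead, Σ_a |line a| = Σ_p |pencil p| ≤ v χ, since the
-- lines through a point form a clique and so receive distinct colours. Thus χ² ≤ f(G) ≤ v χ.
module Submission where

open import Defs
open import Data.Nat using (ℕ; _≤_; _*_)
open import Data.Fin using (Fin)

open import Data.Bool using (Bool; true; false)
open import Data.Fin using (zero; suc; _≟_)
open import Data.Fin.Properties using (suc-injective; injective⇒≤)
open import Data.Fin.Subset using (Subset; inside; outside; _∈_; ∣_∣)
open import Data.List using (map; allFin; tabulate)
open import Data.List.Properties using (map-tabulate)
open import Data.Nat using (zero; suc; _+_; _⊔_; z≤n)
open import Data.Nat.ListAction using (sum)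
open import Data.Nat.Properties using (+-0-commutativeMonoid; +-mono-≤; ⊔-lub; *-cancelʳ-≤; module ≤-Reasoning)
open import Algebra.Properties.CommutativeMonoid.Sum +-0-commutativeMonoid
  using (sum-syntax; ∑-comm; sum-cong-≗)
open import Data.Product using (_,_; _×_; ∃-syntax; proj₁; proj₂)
open import Data.Vec as Vec using ([]; _∷_; lookup; here; there)
open import Data.Vec.Properties using (lookup⇒[]=; []=⇒lookup; lookup∘tabulate)
open import Function using (_∘_; id)
open import Relation.Binary.PropositionalEquality
open import Relation.Nullary using (yes; no; contradiction)

sum-tabulate : ∀ {n} (f : Fin n → ℕ) → sum (tabulate f) ≡ ∑[ i < n ] f i
sum-tabulate {zero}  f = refl
sum-tabulate {suc n} f = cong (f zero +_) (sum-tabulate (f ∘ suc))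

∑-mono-≤ : ∀ {n} {f g : Fin n → ℕ} → (∀ i → f i ≤ g i) → ∑[ i < n ] f i ≤ ∑[ i < n ] g i
∑-mono-≤ {zero}  f≤g = z≤n
∑-mono-≤ {suc n} f≤g = +-mono-≤ (f≤g zero) (∑-mono-≤ (f≤g ∘ suc))

∑-const : ∀ n k → ∑[ i < n ] k ≡ n * k
∑-const zero    k = refl
∑-const (suc n) k = cong (k +_) (∑-const n k)

boolToℕ : Bool → ℕ
boolToℕ false = 0
boolToℕ true  = 1

∣p∣≡∑lookup : ∀ {m} (p : Subset m) → ∣ p ∣ ≡ ∑[ i < m ] boolToℕ (lookup p i)
∣p∣≡∑lookup []            = refl
∣p∣≡∑lookup (inside  ∷ p) = cong suc (∣p∣≡∑lookup p)
∣p∣≡∑lookup (outside ∷ p) = ∣p∣≡∑lookup p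

element : ∀ {m} (p : Subset m) → Fin ∣ p ∣ → Fin m
element (inside  ∷ p) zero    = zero
element (inside  ∷ p) (suc i) = suc (element p i)
element (outside ∷ p) i       = suc (element p i)

element-∈ : ∀ {m} (p : Subset m) i → element p i ∈ p
element-∈ (inside  ∷ p) zero    = here
element-∈ (inside  ∷ p) (suc i) = there (element-∈ p i)
element-∈ (outside ∷ p) i       = there (element-∈ p i)

element-injective : ∀ {m} (p : Subset m) {i j} → element p i ≡ element p j → i ≡ j
element-injective (inside  ∷ p) {zero}  {zero}  _  = refl
element-injective (inside  ∷ p) {zero}  {suc j} ()
element-injective (inside  ∷ p) {suc i} {zero}  ()
element-injective (inside  ∷ p) {suc i} {suc j} eq =
  cong suc (element-injective p (suc-injective eq))
element-injective (outside ∷ p) eq = element-injective p (suc-injective eq)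

index : ∀ {m} (p : Subset m) {x} → x ∈ p → Fin ∣ p ∣
index (inside  ∷ p) here        = zero
index (inside  ∷ p) (there x∈p) = suc (index p x∈p)
index (outside ∷ p) (there x∈p) = index p x∈p

element-index : ∀ {m} (p : Subset m) {x} (x∈p : x ∈ p) → element p (index p x∈p) ≡ x
element-index (inside  ∷ p) here        = refl
element-index (inside  ∷ p) (there x∈p) = cong suc (element-index p x∈p)
element-index (outside ∷ p) (there x∈p) = cong suc (element-index p x∈p)

index-injective : ∀ {m} (p : Subset m) {x y} (x∈p : x ∈ p) (y∈p : y ∈ p) →
                  index p x∈p ≡ index p y∈p → x ≡ y
index-injective p x∈p y∈p eq =
  trans (sym (element-index p x∈p)) (trans (cong (element p) eq) (element-index p y∈p))

injectiveOn⇒∣p∣≤ : ∀ {m k} (p : Subset m) (f : Fin m → Fin k) →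
                   (∀ {x y} → x ∈ p → y ∈ p → f x ≡ f y → x ≡ y) → ∣ p ∣ ≤ k
injectiveOn⇒∣p∣≤ p f inj =
  injective⇒≤ (element-injective p ∘ inj (element-∈ p _) (element-∈ p _))

dual : ∀ {n m} → (Fin n → Subset m) → Fin m → Subset n
dual M x = Vec.tabulate (λ a → lookup (M a) x)

∈-dual⇒∈ : ∀ {n m} (M : Fin n → Subset m) {x a} → a ∈ dual M x → x ∈ M a
∈-dual⇒∈ M {x} {a} a∈ =
  lookup⇒[]= x (M a) (trans (sym (lookup∘tabulate (λ b → lookup (M b) x) a)) ([]=⇒lookup a∈))

∑∣M∣≡∑∣dual∣ : ∀ {n m} (M : Fin n → Subset m) →
               ∑[ a < n ] ∣ M a ∣ ≡ ∑[ x < m ] ∣ dual M x ∣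
∑∣M∣≡∑∣dual∣ {n} {m} M = begin
  ∑[ a < n ] ∣ M a ∣                             ≡⟨ sum-cong-≗ (∣p∣≡∑lookup ∘ M) ⟩
  ∑[ a < n ] ∑[ x < m ] boolToℕ (lookup (M a) x) ≡⟨ ∑-comm (λ a x → boolToℕ (lookup (M a) x)) ⟩
  ∑[ x < m ] ∑[ a < n ] boolToℕ (lookup (M a) x) ≡⟨ sum-cong-≗ column ⟨
  ∑[ x < m ] ∣ dual M x ∣                         ∎
  where
  open ≡-Reasoning
  column : ∀ x → ∣ dual M x ∣ ≡ ∑[ a < n ] boolToℕ (lookup (M a) x)
  column x = trans (∣p∣≡∑lookup (dual M x))
                   (sum-cong-≗ (cong boolToℕ ∘ lookup∘tabulate (λ a → lookup (M a) x)))

Adj⇒≢ : ∀ {n} (G : Graph n) {a b} → Adj G a b → a ≢ b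
Adj⇒≢ G {a} ab refl with trans (sym ab) (adj-irr G a)
... | ()

module LinearRepresentation {n m} (G : Graph n) (rep : LinearRep G m) where

  line : Fin n → Subset m
  line = proj₁ rep

  two≤∣line∣ : ∀ a → 2 ≤ ∣ line a ∣
  two≤∣line∣ = proj₁ (proj₂ rep)

  meet⇒Adj : ∀ a b → a ≢ b → ∃[ p ] (p ∈ line a × p ∈ line b) → Adj G a b
  meet⇒Adj = proj₂ (proj₂ (proj₂ (proj₂ (proj₂ rep))))

  pencil : Fin m → Subset n
  pencil = dual line

  meetingPoint : ∀ {a b} → Adj G a b → ∃[ p ] (p ∈ line a × p ∈ line b)
  meetingPoint {a} {b} ab = proj₁ (proj₂ (proj₂ (proj₂ (proj₂ rep)))) a b (Adj⇒≢ G ab) ab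

  nbhdPartitionByPoints : ∀ a → CliquePartitionNbhd G a ∣ line a ∣
  nbhdPartitionByPoints a = label , sameLabel⇒Adj
    where
    label : ∀ b → Adj G a b → Fin ∣ line a ∣
    label b ab = index (line a) (proj₁ (proj₂ (meetingPoint ab)))

    sameLabel⇒Adj : ∀ b b' (ab : Adj G a b) (ab' : Adj G a b') →
                    label b ab ≡ label b' ab' → b ≢ b' → Adj G b b'
    sameLabel⇒Adj b b' ab ab' eq b≢b'
      with meetingPoint ab | meetingPoint ab'
    ... | p , p∈a , p∈b | p' , p'∈a , p'∈b' with index-injective (line a) p∈a p'∈a eq
    ... | refl = meet⇒Adj b b' b≢b' (p , p∈b , p'∈b')

  θ≤∣line∣ : ∀ {a t} → IsTheta G a t → t ≤ ∣ line a ∣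
  θ≤∣line∣ {a} (_ , minimal) = minimal ∣ line a ∣ (nbhdPartitionByPoints a)

  fFrom≤∑∣line∣ : ∀ {θ} → (∀ a → IsTheta G a (θ a)) → fFrom θ ≤ ∑[ a < n ] ∣ line a ∣
  fFrom≤∑∣line∣ {θ} isθ = begin
    sum (map (λ a → θ a ⊔ 2) (allFin n)) ≡⟨ cong sum (map-tabulate id (λ a → θ a ⊔ 2)) ⟩
    sum (tabulate (λ a → θ a ⊔ 2))       ≡⟨ sum-tabulate (λ a → θ a ⊔ 2) ⟩
    ∑[ a < n ] (θ a ⊔ 2)                 ≤⟨ ∑-mono-≤ (λ a → ⊔-lub (θ≤∣line∣ (isθ a)) (two≤∣line∣ a)) ⟩
    ∑[ a < n ] ∣ line a ∣                ∎
    where open ≤-Reasoning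

  ∣pencil∣≤ : ∀ {k} → Colouring G k → ∀ p → ∣ pencil p ∣ ≤ k
  ∣pencil∣≤ (c , proper) p = injectiveOn⇒∣p∣≤ (pencil p) c sameColour⇒≡
    where
    sameColour⇒≡ : ∀ {a b} → a ∈ pencil p → b ∈ pencil p → c a ≡ c b → a ≡ b
    sameColour⇒≡ {a} {b} a∈ b∈ eq with a ≟ b
    ... | yes a≡b = a≡b
    ... | no a≢b  = contradiction eq
      (proper a b (meet⇒Adj a b a≢b (p , ∈-dual⇒∈ line a∈ , ∈-dual⇒∈ line b∈)))

  ∑∣line∣≤m*k : ∀ {k} → Colouring G k → ∑[ a < n ] ∣ line a ∣ ≤ m * k
  ∑∣line∣≤m*k {k} colouring = begin
    ∑[ a < n ] ∣ line a ∣   ≡⟨ ∑∣M∣≡∑∣dual∣ line ⟩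
    ∑[ p < m ] ∣ pencil p ∣ ≤⟨ ∑-mono-≤ (∣pencil∣≤ colouring) ⟩
    ∑[ p < m ] k            ≡⟨ ∑-const m k ⟩
    m * k                   ∎
    where open ≤-Reasoning

m*m≤n*m⇒m≤n : ∀ m n → m * m ≤ n * m → m ≤ n
m*m≤n*m⇒m≤n zero    n _  = z≤n
m*m≤n*m⇒m≤n (suc m) n le = *-cancelʳ-≤ (suc m) n (suc m) le

mainTheorem19 : (n : ℕ) (G : Graph n) (θ : Fin n → ℕ) (χ v : ℕ) →
    (∀ a → IsTheta G a (θ a)) →
    IsChromaticNumber G χ →
    IsV G v →
    χ * χ ≤ fFrom θ →
    χ ≤ v
mainTheorem19 n G θ χ v isθ (colouring , _) (rep , _) χ²≤f = m*m≤n*m⇒m≤n χ v (begin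
  χ * χ                 ≤⟨ χ²≤f ⟩
  fFrom θ               ≤⟨ fFrom≤∑∣line∣ isθ ⟩
  ∑[ a < n ] ∣ line a ∣ ≤⟨ ∑∣line∣≤m*k colouring ⟩
  v * χ                 ∎)
  where
  open ≤-Reasoning
  open LinearRepresentation G rep
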